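{- Let $m$ be a positive integer and let $(a_{1,m},\dots,a_{m,m})$ be the solution of the linear system \[ \sum_{k=1}^{m} k^{2j}\, a_{k,m} = \begin{cases} 1 & j=1,\\ 0 & 2\le j\le m,\end{cases}\qquad j=1,\dots,m, \] i.e. $\begin{bmatrix} 1 & 2^2 & \cdots & m^2\\ 1 & 2^4 & \cdots & m^4\\ \vdots & & & \vdots\\ 1 & 2^{2m} & \cdots & m^{2m}\end{bmatrix}\begin{bmatrix}a_{1,m}\\ \vdots\\ a_{m,m}\end{bmatrix}=\begin{bmatrix}1\\0\\ \vdots\\0\end{bmatrix}$. Then for each $1\le k\le m$, \[ a_{k,m}=(-1)^{k+1}\frac{2\binom{2m}{m-k}}{k^2\binom{2m}{m}}. \] -}

module Defs where

open import Data.Nat as ℕ using (ℕ; zero; suc; _≤_; _<_; z≤n; s≤s; NonZero; >-nonZero; _∸_)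
open import Data.Nat.Properties using (m*n≢0; ≤-trans; m≤m+n; <-≤-trans; ≤∧≢⇒<; ≤-refl)
open import Data.Nat.Combinatorics using (_C_; nCn≡1; nCk+nC[k+1]≡[n+1]C[k+1])
open import Data.Integer as ℤ using (ℤ; +_; -[1+_])
open import Data.Rational as ℚ using (ℚ; 0ℚ; 1ℚ; _/_)
open import Data.Fin using (Fin; zero; suc; toℕ)
open import Relation.Nullary using (yes; no)
open import Relation.Binary.PropositionalEquality using (_≡_; refl; subst; sym)

⟦_⟧ : ℕ → ℚ
⟦ n ⟧ = + n / 1

Σ : ∀ {n} → (Fin n → ℚ) → ℚ
Σ {zero}  f = 0ℚ
Σ {suc n} f = f zero ℚ.+ Σ (λ i → f (suc i))

-- the index k = 1, …, m corresponding to i : Fin m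
idx : ∀ {m} → Fin m → ℕ
idx i = suc (toℕ i)

e₁ : ∀ {m} → Fin m → ℚ
e₁ zero    = 1ℚ
e₁ (suc _) = 0ℚ

Solves : (m : ℕ) → (Fin m → ℚ) → Set
Solves m a = (j : Fin m) →
  Σ (λ k → ⟦ idx k ℕ.^ (2 ℕ.* idx j) ⟧ ℚ.* a k) ≡ e₁ j

C-pos : ∀ n k → k ≤ n → 0 < n C k
C-pos n zero _ = s≤s z≤n
C-pos (suc n) (suc k) (s≤s k≤n) with k ℕ.≟ n
... | yes refl = subst (0 <_) (sym (nCn≡1 (suc n))) (s≤s z≤n)
... | no k≢n = subst (0 <_) (nCk+nC[k+1]≡[n+1]C[k+1] n k)
                 (<-≤-trans (C-pos n k k≤n) (m≤m+n _ _))

denom : ℕ → ℕ → ℕ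
denom m k = (k ℕ.* k) ℕ.* ((2 ℕ.* m) C m)

denom-nz : ∀ m k → .{{NonZero k}} → NonZero (denom m k)
denom-nz m k = m*n≢0 (k ℕ.* k) ((2 ℕ.* m) C m) {{m*n≢0 k k}}
  {{>-nonZero (C-pos (2 ℕ.* m) m (m≤m+n m _))}}

formula : (m k : ℕ) → .{{NonZero k}} → ℚ
formula m k = ((-[1+ 0 ] ℤ.^ (k ℕ.+ 1)) ℤ.* + (2 ℕ.* ((2 ℕ.* m) C (m ∸ k))))
                / denom m k
  where instance _ = denom-nz m k

{-# OPTIONS --safe #-}
module Submission where

open import Defs
open import Data.Nat using (ℕ; _≤_)
open import Data.Fin using (Fin)
open import Data.Rational using (ℚ)
open import Function.Bundles using (_⇔_)
open import Relation.Binary.PropositionalEquality using (_≡_)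
open import Data.Maybe using (nothing)
import Data.Rational.Properties
open import Tactic.RingSolver.Core.AlmostCommutativeRing using (AlmostCommutativeRing; fromCommutativeRing)

-- Put b m k = (-1)^(k+1) · 2 · C(2m, m-k), so that the claimed solution is b m k / (k² C(2m, m)).
-- After cancelling k², equation j reads  Σ_k (k²)^(j-1) b m k = δ_{j,1} C(2m, m).  For j = 1 the
-- sum is alternating and telescopes by Pascal's rule.  For j > 1 induct on m: for k ≤ m,
-- ((m+1)² - k²) b (m+1) k = (2m+2)(2m+1) b m k, the term k = m+1 carries the factor 0, and
-- (m+1)² C(2m+2, m+1) = (2m+2)(2m+1) C(2m, m), so equation j at m+1 follows from equation j-1
-- at m and at m+1.
-- Uniqueness: up to the column factors k² this is a Vandermonde system in the distinct nonzero
-- nodes k², whose kernel is trivial.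

ℚ-ring : AlmostCommutativeRing _ _
ℚ-ring = fromCommutativeRing Data.Rational.Properties.+-*-commutativeRing (λ _ → nothing)

module Binomial where

  open import Data.Nat
  open import Data.Nat.Properties
  open import Data.Nat.Combinatorics using (_C_; nC1≡n; nCk≡nC[n∸k]; nCk+nC[k+1]≡[n+1]C[k+1])
  open import Data.Nat.Tactic.RingSolver using (solve-∀)
  open import Algebra.Properties.CommutativeSemigroup *-commutativeSemigroup
    using (xy∙z≈y∙xz; x∙yz≈y∙xz)
  open import Relation.Binary.PropositionalEquality
  open ≡-Reasoning

  central : ℕ → ℕ
  central m = (2 * m) C m

  [m+n]Cm≡[m+n]Cn : ∀ m n → (m + n) C m ≡ (m + n) C n
  [m+n]Cm≡[m+n]Cn m n = trans (nCk≡nC[n∸k] (m≤m+n m n)) (cong ((m + n) C_) (m+n∸m≡n m n))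

  [1+k]*[1+n]C[1+k]≡[1+n]*nCk : ∀ n k → suc k * (suc n C suc k) ≡ suc n * (n C k)
  [1+k]*[1+n]C[1+k]≡[1+n]*nCk zero    zero    = refl
  [1+k]*[1+n]C[1+k]≡[1+n]*nCk zero    (suc k) = *-zeroʳ (2 + k)
  [1+k]*[1+n]C[1+k]≡[1+n]*nCk (suc n) zero    =
    trans (+-identityʳ _) (trans (nC1≡n (2 + n)) (sym (*-identityʳ (2 + n))))
  [1+k]*[1+n]C[1+k]≡[1+n]*nCk (suc n) (suc k) = begin
    (2 + k) * ((2 + n) C (2 + k))    ≡⟨ cong ((2 + k) *_) (nCk+nC[k+1]≡[n+1]C[k+1] (suc n) (suc k)) ⟨
    (2 + k) * (a + b)                ≡⟨ *-distribˡ-+ (2 + k) a b ⟩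
    a + (1 + k) * a + (2 + k) * b    ≡⟨ cong₂ (λ u v → a + u + v) ([1+k]*[1+n]C[1+k]≡[1+n]*nCk n k)
                                                                ([1+k]*[1+n]C[1+k]≡[1+n]*nCk n (suc k)) ⟩
    a + (1 + n) * c + (1 + n) * d    ≡⟨ +-assoc a _ _ ⟩
    a + ((1 + n) * c + (1 + n) * d)  ≡⟨ cong (a +_) (*-distribˡ-+ (1 + n) c d) ⟨
    a + (1 + n) * (c + d)            ≡⟨ cong (λ u → a + (1 + n) * u) (nCk+nC[k+1]≡[n+1]C[k+1] n k) ⟩
    a + (1 + n) * a                  ∎
    where
    a = suc n C suc k
    b = suc n C suc (suc k)
    c = n C k
    d = n C suc k

  [1+r]*[1+s]*[2+r+s]C[1+r]≡[2+r+s]*[1+r+s]*[r+s]Cr : ∀ r s →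
    suc r * suc s * ((2 + r + s) C suc r) ≡ (2 + r + s) * (1 + r + s) * ((r + s) C r)
  [1+r]*[1+s]*[2+r+s]C[1+r]≡[2+r+s]*[1+r+s]*[r+s]Cr r s = begin
    suc r * suc s * ((2 + r + s) C suc r)
      ≡⟨ xy∙z≈y∙xz (suc r) (suc s) ((2 + r + s) C suc r) ⟩
    suc s * (suc r * ((2 + r + s) C suc r))
      ≡⟨ cong (suc s *_) ([1+k]*[1+n]C[1+k]≡[1+n]*nCk (1 + r + s) r) ⟩
    suc s * ((2 + r + s) * ((1 + r + s) C r))
      ≡⟨ x∙yz≈y∙xz (suc s) (2 + r + s) ((1 + r + s) C r) ⟩
    (2 + r + s) * (suc s * ((1 + r + s) C r))
      ≡⟨ cong (λ c → (2 + r + s) * (suc s * c)) [1+r+s]Cr≡[1+r+s]C[1+s] ⟩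
    (2 + r + s) * (suc s * ((1 + r + s) C suc s))
      ≡⟨ cong ((2 + r + s) *_) ([1+k]*[1+n]C[1+k]≡[1+n]*nCk (r + s) s) ⟩
    (2 + r + s) * ((1 + r + s) * ((r + s) C s))
      ≡⟨ cong (λ c → (2 + r + s) * ((1 + r + s) * c)) ([m+n]Cm≡[m+n]Cn r s) ⟨
    (2 + r + s) * ((1 + r + s) * ((r + s) C r))
      ≡⟨ *-assoc (2 + r + s) (1 + r + s) ((r + s) C r) ⟨
    (2 + r + s) * (1 + r + s) * ((r + s) C r)
      ∎
    where
    [1+r+s]Cr≡[1+r+s]C[1+s] : (1 + r + s) C r ≡ (1 + r + s) C suc s
    [1+r+s]Cr≡[1+r+s]C[1+s] = subst (λ n → n C r ≡ n C suc s) (+-suc r s) ([m+n]Cm≡[m+n]Cn r (suc s))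

  2*m≡m+m : ∀ m → 2 * m ≡ m + m
  2*m≡m+m m = cong (m +_) (+-identityʳ m)

  [1+n]C[m∸t]≡nC[m∸t]+nC[m∸1+t] : ∀ n {m t} → t < m →
    suc n C (m ∸ t) ≡ n C (m ∸ t) + n C (m ∸ suc t)
  [1+n]C[m∸t]≡nC[m∸t]+nC[m∸1+t] n {m} {t} t<m = begin
    suc n C (m ∸ t)                      ≡⟨ cong (suc n C_) m∸t≡1+[m∸1+t] ⟩
    suc n C suc (m ∸ suc t)              ≡⟨ nCk+nC[k+1]≡[n+1]C[k+1] n (m ∸ suc t) ⟨
    n C (m ∸ suc t) + n C suc (m ∸ suc t) ≡⟨ cong (λ j → n C (m ∸ suc t) + n C j) m∸t≡1+[m∸1+t] ⟨
    n C (m ∸ suc t) + n C (m ∸ t)        ≡⟨ +-comm (n C (m ∸ suc t)) (n C (m ∸ t)) ⟩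
    n C (m ∸ t) + n C (m ∸ suc t)        ∎
    where
    m∸t≡1+[m∸1+t] : m ∸ t ≡ suc (m ∸ suc t)
    m∸t≡1+[m∸1+t] = +-∸-assoc 1 t<m

  central-suc : ∀ m → central (suc m) ≡ 2 * ((1 + 2 * m) C m)
  central-suc m = begin
    (2 * suc m) C suc m                    ≡⟨ cong (_C suc m) (*-suc 2 m) ⟩
    (2 + 2 * m) C suc m                    ≡⟨ nCk+nC[k+1]≡[n+1]C[k+1] (1 + 2 * m) m ⟨
    (1 + 2 * m) C m + (1 + 2 * m) C suc m  ≡⟨ cong ((1 + 2 * m) C m +_) [1+2m]C[1+m]≡[1+2m]Cm ⟩
    (1 + 2 * m) C m + (1 + 2 * m) C m      ≡⟨ 2*m≡m+m ((1 + 2 * m) C m) ⟨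
    2 * ((1 + 2 * m) C m)                  ∎
    where
    [1+2m]C[1+m]≡[1+2m]Cm : (1 + 2 * m) C suc m ≡ (1 + 2 * m) C m
    [1+2m]C[1+m]≡[1+2m]Cm =
      subst (λ n → suc n C suc m ≡ suc n C m) (sym (2*m≡m+m m)) ([m+n]Cm≡[m+n]Cn (suc m) m)

  central-recurrence : ∀ m →
    suc m * suc m * central (suc m) ≡ (2 + 2 * m) * (1 + 2 * m) * central m
  central-recurrence m = begin
    suc m * suc m * ((2 * suc m) C suc m)      ≡⟨ cong (λ n → suc m * suc m * (n C suc m)) (*-suc 2 m) ⟩
    suc m * suc m * ((2 + 2 * m) C suc m)      ≡⟨ cong (λ n → suc m * suc m * ((2 + n) C suc m)) (2*m≡m+m m) ⟩
    suc m * suc m * ((2 + m + m) C suc m)      ≡⟨ [1+r]*[1+s]*[2+r+s]C[1+r]≡[2+r+s]*[1+r+s]*[r+s]Cr m m ⟩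
    (2 + m + m) * (1 + m + m) * ((m + m) C m)  ≡⟨ cong (λ n → (2 + n) * (1 + n) * (n C m)) (2*m≡m+m m) ⟨
    (2 + 2 * m) * (1 + 2 * m) * central m      ∎

  -- With r = m ∸ k and s = r + 2k one has (m+1)² = k² + (r+1)(s+1) and 2m = r + s,
  -- which reduces this to the previous identity.
  [2m]C[m∸k]-recurrence : ∀ {k m} → k ≤ m → let X = (2 * suc m) C (suc m ∸ k) in
    suc m * suc m * X ≡ k * k * X + (2 + 2 * m) * (1 + 2 * m) * ((2 * m) C (m ∸ k))
  [2m]C[m∸k]-recurrence {k} {m} k≤m with m ∸ k | m+[n∸m]≡n k≤m
  ... | r | refl = begin
    suc m * suc m * X
      ≡⟨ cong (_* X) (square-split k r) ⟩
    (k * k + suc r * suc s) * X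
      ≡⟨ *-distribʳ-+ X (k * k) _ ⟩
    k * k * X + suc r * suc s * X
      ≡⟨ cong (λ x → k * k * X + suc r * suc s * x) X≡ ⟩
    k * k * X + suc r * suc s * ((2 + r + s) C suc r)
      ≡⟨ cong (k * k * X +_) ([1+r]*[1+s]*[2+r+s]C[1+r]≡[2+r+s]*[1+r+s]*[r+s]Cr r s) ⟩
    k * k * X + (2 + r + s) * (1 + r + s) * ((r + s) C r)
      ≡⟨ cong (λ n → k * k * X + (2 + n) * (1 + n) * (n C r)) (double-split k r) ⟨
    k * k * X + (2 + 2 * m) * (1 + 2 * m) * ((2 * m) C r)
      ∎
    where
    s = r + k + k
    X = (2 * suc m) C (suc m ∸ k)
    square-split : ∀ k r → suc (k + r) * suc (k + r) ≡ k * k + suc r * suc (r + k + k)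
    square-split = solve-∀
    double-split : ∀ k r → 2 * (k + r) ≡ r + (r + k + k)
    double-split = solve-∀
    X≡ : X ≡ (2 + r + s) C suc r
    X≡ = cong₂ _C_ (trans (*-suc 2 m) (cong (2 +_) (double-split k r)))
                   (trans (+-∸-assoc 1 (m≤m+n k r)) (cong suc (m+n∸m≡n k r)))

module Moments where

  open import Data.Nat as ℕ using (ℕ; zero; suc; _≤_; _<_; _∸_; s≤s)
  import Data.Nat.Properties as ℕ
  open import Data.Nat.Combinatorics using (_C_)
  open import Data.Integer using (ℤ; +_; -1ℤ; 0ℤ; 1ℤ; _+_; _*_; _-_; -_; _^_)
  import Data.Integer.Properties as ℤ
  open import Data.Integer.Tactic.RingSolver using (solve-∀)
  open import Data.Fin using (toℕ; inject₁; fromℕ)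
  open import Data.Fin.Properties using (toℕ<n; toℕ-inject₁; toℕ-fromℕ)
  open import Algebra.Properties.Semiring.Sum ℤ.+-*-semiring
    using (sum; sum-cong-≗; sum-init-last; ∑-distrib-+; *-distribˡ-sum)
  open import Algebra.Properties.CommutativeSemigroup ℤ.*-commutativeSemigroup using (x∙yz≈y∙xz)
  open import Algebra.Properties.CommutativeSemigroup ℤ.+-commutativeSemigroup using (xy∙z≈xz∙y)
  open import Function using (_∘_)
  open import Relation.Binary.PropositionalEquality
  open ≡-Reasoning
  open Binomial

  sign : ℕ → ℤ
  sign k = -1ℤ ^ k

  sign-suc : ∀ k → sign (suc k) ≡ - sign k
  sign-suc k = ℤ.-1*i≡-i (sign k)

  sign-2+ : ∀ k → sign (2 ℕ.+ k) ≡ sign k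
  sign-2+ k = trans (sign-suc (suc k)) (trans (cong -_ (sign-suc k)) (ℤ.neg-involutive (sign k)))

  -- formula m k is definitionally b m k / (k * k * central m).
  b : ℕ → ℕ → ℤ
  b m k = sign (k ℕ.+ 1) * + (2 ℕ.* ((2 ℕ.* m) C (m ∸ k)))

  δ : ℕ → ℤ
  δ zero    = 1ℤ
  δ (suc _) = 0ℤ

  moment : ℕ → ℕ → ℤ
  moment m p = sum {m} (λ i → + ((idx i ℕ.* idx i) ℕ.^ p) * b m (idx i))

  sum-last : ∀ n (f : ℕ → ℤ) → sum {suc n} (f ∘ toℕ) ≡ sum {n} (f ∘ toℕ) + f n
  sum-last n f = begin
    sum {suc n} (f ∘ toℕ)                           ≡⟨ sum-init-last {n} (f ∘ toℕ) ⟩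
    sum {n} (f ∘ toℕ ∘ inject₁) + f (toℕ (fromℕ n)) ≡⟨ cong₂ _+_ (sum-cong-≗ {n} (cong f ∘ toℕ-inject₁))
                                                                 (cong f (toℕ-fromℕ n)) ⟩
    sum {n} (f ∘ toℕ) + f n                         ∎

  alternating-telescope : ∀ (g : ℕ → ℤ) n →
    sum {n} (λ i → sign (toℕ i) * (g (toℕ i) + g (suc (toℕ i)))) ≡ g 0 - sign n * g n
  alternating-telescope g zero = x-1x≡0 (g 0)
    where
    x-1x≡0 : ∀ x → 0ℤ ≡ x - 1ℤ * x
    x-1x≡0 = solve-∀
  alternating-telescope g (suc n) = begin
    sum {suc n} (T ∘ toℕ)                          ≡⟨ sum-last n T ⟩
    sum {n} (T ∘ toℕ) + T n                        ≡⟨ cong (_+ T n) (alternating-telescope g n) ⟩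
    g 0 - sign n * g n + sign n * (g n + g (suc n)) ≡⟨ step (g 0) (sign n) (g n) (g (suc n)) ⟩
    g 0 - - sign n * g (suc n)                     ≡⟨ cong (λ s → g 0 - s * g (suc n)) (sign-suc n) ⟨
    g 0 - sign (suc n) * g (suc n)                 ∎
    where
    T : ℕ → ℤ
    T t = sign t * (g t + g (suc t))
    step : ∀ a s x y → a - s * x + s * (x + y) ≡ a - - s * y
    step = solve-∀

  +a*[s*+[2c]]≡s*+[2ac] : ∀ a c s → + a * (s * + (2 ℕ.* c)) ≡ s * + (2 ℕ.* (a ℕ.* c))
  +a*[s*+[2c]]≡s*+[2ac] a c s = begin
    + a * (s * + (2 ℕ.* c))       ≡⟨ cong (λ x → + a * (s * x)) (ℤ.pos-* 2 c) ⟩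
    + a * (s * (+ 2 * + c))       ≡⟨ reorder (+ a) s (+ 2) (+ c) ⟩
    s * (+ 2 * (+ a * + c))       ≡⟨ cong (λ x → s * (+ 2 * x)) (ℤ.pos-* a c) ⟨
    s * (+ 2 * + (a ℕ.* c))       ≡⟨ cong (s *_) (ℤ.pos-* 2 (a ℕ.* c)) ⟨
    s * + (2 ℕ.* (a ℕ.* c))       ∎
    where
    reorder : ∀ a s t c → a * (s * (t * c)) ≡ s * (t * (a * c))
    reorder = solve-∀

  b-recurrence : ∀ {k m} → k ≤ m →
    + (suc m ℕ.* suc m) * b (suc m) k ≡
    + (k ℕ.* k) * b (suc m) k + + ((2 ℕ.+ 2 ℕ.* m) ℕ.* (1 ℕ.+ 2 ℕ.* m)) * b m k
  b-recurrence {k} {m} k≤m = begin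
    + Q * (s * + (2 ℕ.* X))
      ≡⟨ +a*[s*+[2c]]≡s*+[2ac] Q X s ⟩
    s * + (2 ℕ.* (Q ℕ.* X))
      ≡⟨ cong (λ n → s * + (2 ℕ.* n)) ([2m]C[m∸k]-recurrence k≤m) ⟩
    s * + (2 ℕ.* (K ℕ.* X ℕ.+ R ℕ.* Y))
      ≡⟨ cong (λ n → s * + n) (ℕ.*-distribˡ-+ 2 (K ℕ.* X) (R ℕ.* Y)) ⟩
    s * + (2 ℕ.* (K ℕ.* X) ℕ.+ 2 ℕ.* (R ℕ.* Y))
      ≡⟨ cong (s *_) (ℤ.pos-+ (2 ℕ.* (K ℕ.* X)) (2 ℕ.* (R ℕ.* Y))) ⟩
    s * (+ (2 ℕ.* (K ℕ.* X)) + + (2 ℕ.* (R ℕ.* Y)))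
      ≡⟨ ℤ.*-distribˡ-+ s (+ (2 ℕ.* (K ℕ.* X))) (+ (2 ℕ.* (R ℕ.* Y))) ⟩
    s * + (2 ℕ.* (K ℕ.* X)) + s * + (2 ℕ.* (R ℕ.* Y))
      ≡⟨ cong₂ _+_ (+a*[s*+[2c]]≡s*+[2ac] K X s) (+a*[s*+[2c]]≡s*+[2ac] R Y s) ⟨
    + K * (s * + (2 ℕ.* X)) + + R * (s * + (2 ℕ.* Y))
      ∎
    where
    s = sign (k ℕ.+ 1)
    Q = suc m ℕ.* suc m
    K = k ℕ.* k
    R = (2 ℕ.+ 2 ℕ.* m) ℕ.* (1 ℕ.+ 2 ℕ.* m)
    X = (2 ℕ.* suc m) C (suc m ∸ k)
    Y = (2 ℕ.* m) C (m ∸ k)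

  moment-recurrence : ∀ m p →
    + (suc m ℕ.* suc m) * moment (suc m) p ≡
    moment (suc m) (suc p) + + ((2 ℕ.+ 2 ℕ.* m) ℕ.* (1 ℕ.+ 2 ℕ.* m)) * moment m p
  moment-recurrence m p = begin
    Q * moment (suc m) p
      ≡⟨ *-distribˡ-sum {suc m} Q (F ∘ idx) ⟩
    sum {suc m} (λ i → Q * F (idx i))
      ≡⟨ sum-last m (λ t → Q * F (suc t)) ⟩
    sum {m} (λ i → Q * F (idx i)) + Q * F (suc m)
      ≡⟨ cong₂ _+_ (sum-cong-≗ (λ i → inner-term (toℕ<n i))) top-term ⟩
    sum {m} (λ i → G (idx i) + R * H (idx i)) + G (suc m)
      ≡⟨ cong (_+ G (suc m)) (∑-distrib-+ {m} (G ∘ idx) (λ i → R * H (idx i))) ⟩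
    sum {m} (G ∘ idx) + sum {m} (λ i → R * H (idx i)) + G (suc m)
      ≡⟨ cong (λ x → sum {m} (G ∘ idx) + x + G (suc m)) (*-distribˡ-sum {m} R (H ∘ idx)) ⟨
    sum {m} (G ∘ idx) + R * moment m p + G (suc m)
      ≡⟨ xy∙z≈xz∙y (sum {m} (G ∘ idx)) (R * moment m p) (G (suc m)) ⟩
    sum {m} (G ∘ idx) + G (suc m) + R * moment m p
      ≡⟨ cong (_+ R * moment m p) (sum-last m (G ∘ suc)) ⟨
    moment (suc m) (suc p) + R * moment m p
      ∎
    where
    Q = + (suc m ℕ.* suc m)
    R = + ((2 ℕ.+ 2 ℕ.* m) ℕ.* (1 ℕ.+ 2 ℕ.* m))
    F G H : ℕ → ℤ
    F k = + ((k ℕ.* k) ℕ.^ p) * b (suc m) k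
    G k = + ((k ℕ.* k) ℕ.^ suc p) * b (suc m) k
    H k = + ((k ℕ.* k) ℕ.^ p) * b m k
    top-term : Q * F (suc m) ≡ G (suc m)
    top-term = begin
      Q * (+ P * b (suc m) (suc m))  ≡⟨ ℤ.*-assoc Q (+ P) (b (suc m) (suc m)) ⟨
      Q * + P * b (suc m) (suc m)    ≡⟨ cong (_* b (suc m) (suc m)) (ℤ.pos-* (suc m ℕ.* suc m) P) ⟨
      G (suc m)                      ∎
      where
      P = (suc m ℕ.* suc m) ℕ.^ p
    inner-term : ∀ {k} → k ≤ m → Q * F k ≡ G k + R * H k
    inner-term {k} k≤m = begin
      Q * (P * b (suc m) k)
        ≡⟨ x∙yz≈y∙xz Q P (b (suc m) k) ⟩
      P * (Q * b (suc m) k)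
        ≡⟨ cong (P *_) (b-recurrence k≤m) ⟩
      P * (+ (k ℕ.* k) * b (suc m) k + R * b m k)
        ≡⟨ distribute P (+ (k ℕ.* k)) (b (suc m) k) R (b m k) ⟩
      + (k ℕ.* k) * P * b (suc m) k + R * (P * b m k)
        ≡⟨ cong (λ x → x * b (suc m) k + R * (P * b m k)) (ℤ.pos-* (k ℕ.* k) _) ⟨
      G k + R * H k
        ∎
      where
      P = + ((k ℕ.* k) ℕ.^ p)
      distribute : ∀ p kk x r y → p * (kk * x + r * y) ≡ kk * p * x + r * (p * y)
      distribute = solve-∀

  moment-zero : ∀ m → moment (suc m) 0 ≡ + central (suc m)
  moment-zero m = begin
    moment (suc m) 0
      ≡⟨ sum-cong-≗ {suc m} (λ i → ℤ.*-identityˡ (b (suc m) (idx i))) ⟩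
    sum {suc m} (b (suc m) ∘ idx)
      ≡⟨ sum-last m (b (suc m) ∘ suc) ⟩
    sum {m} (b (suc m) ∘ idx) + b (suc m) (suc m)
      ≡⟨ cong₂ _+_ (sum-cong-≗ {m} (λ i → b-pascal (toℕ<n i))) b-top ⟩
    sum {m} (λ i → + 2 * T (toℕ i)) + + 2 * sign m
      ≡⟨ cong (_+ + 2 * sign m) (*-distribˡ-sum {m} (+ 2) (T ∘ toℕ)) ⟨
    + 2 * sum {m} (T ∘ toℕ) + + 2 * sign m
      ≡⟨ cong (λ x → + 2 * x + + 2 * sign m) (alternating-telescope g m) ⟩
    + 2 * (g 0 - sign m * g m) + + 2 * sign m
      ≡⟨ cong (λ j → + 2 * (g 0 - sign m * + (n C j)) + + 2 * sign m) (ℕ.n∸n≡0 m) ⟩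
    + 2 * (g 0 - sign m * 1ℤ) + + 2 * sign m
      ≡⟨ cancel (+ 2) (g 0) (sign m) ⟩
    + 2 * g 0
      ≡⟨ ℤ.pos-* 2 (n C m) ⟨
    + (2 ℕ.* (n C m))
      ≡⟨ cong +_ (central-suc m) ⟨
    + central (suc m)
      ∎
    where
    n = 1 ℕ.+ 2 ℕ.* m
    g T : ℕ → ℤ
    g j = + (n C (m ∸ j))
    T t = sign t * (g t + g (suc t))
    b-pascal : ∀ {t} → t < m → b (suc m) (suc t) ≡ + 2 * T t
    b-pascal {t} t<m = begin
      sign (suc t ℕ.+ 1) * + (2 ℕ.* ((2 ℕ.* suc m) C (m ∸ t)))
        ≡⟨ cong₂ (λ k c → sign k * + (2 ℕ.* (c C (m ∸ t)))) (ℕ.+-comm (suc t) 1) (ℕ.*-suc 2 m) ⟩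
      sign (2 ℕ.+ t) * + (2 ℕ.* (suc n C (m ∸ t)))
        ≡⟨ cong₂ (λ s c → s * + (2 ℕ.* c)) (sign-2+ t) ([1+n]C[m∸t]≡nC[m∸t]+nC[m∸1+t] n t<m) ⟩
      sign t * + (2 ℕ.* (n C (m ∸ t) ℕ.+ n C (m ∸ suc t)))
        ≡⟨ cong (sign t *_) (trans (ℤ.pos-* 2 (n C (m ∸ t) ℕ.+ n C (m ∸ suc t)))
                                   (cong (+ 2 *_) (ℤ.pos-+ (n C (m ∸ t)) (n C (m ∸ suc t))))) ⟩
      sign t * (+ 2 * (g t + g (suc t)))
        ≡⟨ x∙yz≈y∙xz (sign t) (+ 2) (g t + g (suc t)) ⟩
      + 2 * T t ∎
    b-top : b (suc m) (suc m) ≡ + 2 * sign m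
    b-top = begin
      sign (suc m ℕ.+ 1) * + (2 ℕ.* ((2 ℕ.* suc m) C (m ∸ m)))
        ≡⟨ cong₂ (λ k j → sign k * + (2 ℕ.* ((2 ℕ.* suc m) C j))) (ℕ.+-comm (suc m) 1) (ℕ.n∸n≡0 m) ⟩
      sign (2 ℕ.+ m) * + 2  ≡⟨ cong (_* + 2) (sign-2+ m) ⟩
      sign m * + 2          ≡⟨ ℤ.*-comm (sign m) (+ 2) ⟩
      + 2 * sign m          ∎
    cancel : ∀ c x s → c * (x - s * 1ℤ) + c * s ≡ c * x
    cancel = solve-∀

  moments : ∀ m p → p < m → moment m p ≡ δ p * + central m
  moments (suc m) zero    _         = trans (moment-zero m) (sym (ℤ.*-identityˡ _))
  moments (suc m) (suc p) (s≤s p<m) = begin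
    moment (suc m) (suc p)
      ≡⟨ x≡x+y-y (moment (suc m) (suc p)) (R * moment m p) ⟩
    moment (suc m) (suc p) + R * moment m p - R * moment m p
      ≡⟨ cong (_- R * moment m p) (moment-recurrence m p) ⟨
    Q * moment (suc m) p - R * moment m p
      ≡⟨ cong₂ (λ x y → Q * x - R * y) (moments (suc m) p (ℕ.m≤n⇒m≤1+n p<m)) (moments m p p<m) ⟩
    Q * (δ p * + central (suc m)) - R * (δ p * + central m)
      ≡⟨ cong (_- R * (δ p * + central m)) (x∙yz≈y∙xz Q (δ p) (+ central (suc m))) ⟩
    δ p * (Q * + central (suc m)) - R * (δ p * + central m)
      ≡⟨ cong (λ x → δ p * x - R * (δ p * + central m)) central-recurrenceℤ ⟩
    δ p * (R * + central m) - R * (δ p * + central m)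
      ≡⟨ vanish (δ p) R (+ central m) (+ central (suc m)) ⟩
    0ℤ * + central (suc m)
      ∎
    where
    Q = + (suc m ℕ.* suc m)
    R = + ((2 ℕ.+ 2 ℕ.* m) ℕ.* (1 ℕ.+ 2 ℕ.* m))
    central-recurrenceℤ : Q * + central (suc m) ≡ R * + central m
    central-recurrenceℤ = begin
      Q * + central (suc m)                                  ≡⟨ ℤ.pos-* (suc m ℕ.* suc m) (central (suc m)) ⟨
      + (suc m ℕ.* suc m ℕ.* central (suc m))                ≡⟨ cong +_ (central-recurrence m) ⟩
      + ((2 ℕ.+ 2 ℕ.* m) ℕ.* (1 ℕ.+ 2 ℕ.* m) ℕ.* central m) ≡⟨ ℤ.pos-* ((2 ℕ.+ 2 ℕ.* m) ℕ.* (1 ℕ.+ 2 ℕ.* m)) _ ⟩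
      R * + central m                                        ∎
    x≡x+y-y : ∀ x y → x ≡ x + y - y
    x≡x+y-y = solve-∀
    vanish : ∀ d r c c′ → d * (r * c) - r * (d * c) ≡ 0ℤ * c′
    vanish = solve-∀

module Fractions where

  open import Data.Nat as ℕ using (zero; suc; NonZero)
  import Data.Nat.Properties as ℕ
  open import Data.Integer as ℤ using (+_)
  import Data.Integer.Properties as ℤ
  open import Data.Integer.Tactic.RingSolver using (solve-∀)
  open import Data.Rational using (_/_; _+_; _*_; fromℚᵘ; +-*-rawSemiring)
  open import Algebra.Definitions.RawSemiring +-*-rawSemiring using (_^_)
  open import Data.Rational.Properties
    using (toℚᵘ-injective; toℚᵘ-fromℚᵘ; fromℚᵘ-cong; fromℚᵘ-injective; toℚᵘ-homo-+; toℚᵘ-homo-*)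
  open import Data.Rational.Unnormalised as ℚᵘ using (mkℚᵘ; *≡*)
  import Data.Rational.Unnormalised.Properties as ℚᵘ
  open import Relation.Binary.PropositionalEquality
  open ≡-Reasoning

  private instance
    *-nonZero : ∀ {m n} .{{_ : NonZero m}} .{{_ : NonZero n}} → NonZero (m ℕ.* n)
    *-nonZero {m} {n} = ℕ.m*n≢0 m n

  fromℚᵘ-homo-+ : ∀ p q → fromℚᵘ (p ℚᵘ.+ q) ≡ fromℚᵘ p + fromℚᵘ q
  fromℚᵘ-homo-+ p q = toℚᵘ-injective (ℚᵘ.≃-trans (toℚᵘ-fromℚᵘ (p ℚᵘ.+ q))
    (ℚᵘ.≃-sym (ℚᵘ.≃-trans (toℚᵘ-homo-+ (fromℚᵘ p) (fromℚᵘ q))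
                          (ℚᵘ.+-cong (toℚᵘ-fromℚᵘ p) (toℚᵘ-fromℚᵘ q)))))

  fromℚᵘ-homo-* : ∀ p q → fromℚᵘ (p ℚᵘ.* q) ≡ fromℚᵘ p * fromℚᵘ q
  fromℚᵘ-homo-* p q = toℚᵘ-injective (ℚᵘ.≃-trans (toℚᵘ-fromℚᵘ (p ℚᵘ.* q))
    (ℚᵘ.≃-sym (ℚᵘ.≃-trans (toℚᵘ-homo-* (fromℚᵘ p) (fromℚᵘ q))
                          (ℚᵘ.*-cong (toℚᵘ-fromℚᵘ p) (toℚᵘ-fromℚᵘ q)))))

  /-cross : ∀ p q r s .{{_ : NonZero q}} .{{_ : NonZero s}} →
    p ℤ.* + s ≡ r ℤ.* + q → p / q ≡ r / s
  /-cross p (suc q-1) r (suc s-1) eq = fromℚᵘ-cong {mkℚᵘ p q-1} {mkℚᵘ r s-1} (*≡* eq)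

  /-* : ∀ p q r s .{{_ : NonZero q}} .{{_ : NonZero s}} →
    (p / q) * (r / s) ≡ (p ℤ.* r) / (q ℕ.* s)
  /-* p (suc q) r (suc s) = sym (fromℚᵘ-homo-* (mkℚᵘ p q) (mkℚᵘ r s))

  /-+ : ∀ p r d .{{_ : NonZero d}} → (p / d) + (r / d) ≡ (p ℤ.+ r) / d
  /-+ p r d@(suc d-1) = trans (sym (fromℚᵘ-homo-+ (mkℚᵘ p d-1) (mkℚᵘ r d-1)))
                                    (/-cross (p ℤ.* + d ℤ.+ r ℤ.* + d) (d ℕ.* d) (p ℤ.+ r) d cross)
    where
    cross : (p ℤ.* + d ℤ.+ r ℤ.* + d) ℤ.* + d ≡ (p ℤ.+ r) ℤ.* + (d ℕ.* d)
    cross = trans (factor p r (+ d)) (cong ((p ℤ.+ r) ℤ.*_) (ℤ.pos-* d d))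
      where
      factor : ∀ p r d → (p ℤ.* d ℤ.+ r ℤ.* d) ℤ.* d ≡ (p ℤ.+ r) ℤ.* (d ℤ.* d)
      factor = solve-∀

  ⟦⟧-* : ∀ a b → ⟦ a ℕ.* b ⟧ ≡ ⟦ a ⟧ * ⟦ b ⟧
  ⟦⟧-* a b = sym (trans (/-* (+ a) 1 (+ b) 1) (cong (_/ 1) (sym (ℤ.pos-* a b))))

  ⟦⟧-^ : ∀ a n → ⟦ a ℕ.^ n ⟧ ≡ ⟦ a ⟧ ^ n
  ⟦⟧-^ a zero    = refl
  ⟦⟧-^ a (suc n) = trans (⟦⟧-* a (a ℕ.^ n)) (cong (⟦ a ⟧ *_) (⟦⟧-^ a n))

  ⟦⟧-injective : ∀ {a b} → ⟦ a ⟧ ≡ ⟦ b ⟧ → a ≡ b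
  ⟦⟧-injective {a} {b} eq with fromℚᵘ-injective {mkℚᵘ (+ a) 0} {mkℚᵘ (+ b) 0} eq
  ... | *≡* a*1≡b*1 =
    ℤ.+-injective (trans (sym (ℤ.*-identityʳ (+ a))) (trans a*1≡b*1 (ℤ.*-identityʳ (+ b))))

  ⟦n*a⟧*[z/[n*d]]≡[a*z]/d : ∀ n a z d .{{_ : NonZero n}} .{{_ : NonZero d}} →
    ⟦ n ℕ.* a ⟧ * (z / (n ℕ.* d)) ≡ (+ a ℤ.* z) / d
  ⟦n*a⟧*[z/[n*d]]≡[a*z]/d n a z d = trans (/-* (+ (n ℕ.* a)) 1 z (n ℕ.* d))
    (/-cross (+ (n ℕ.* a) ℤ.* z) (1 ℕ.* (n ℕ.* d)) (+ a ℤ.* z) d cross)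
    where
    cross : + (n ℕ.* a) ℤ.* z ℤ.* + d ≡ + a ℤ.* z ℤ.* + (1 ℕ.* (n ℕ.* d))
    cross = begin
      + (n ℕ.* a) ℤ.* z ℤ.* + d             ≡⟨ cong (λ x → x ℤ.* z ℤ.* + d) (ℤ.pos-* n a) ⟩
      + n ℤ.* + a ℤ.* z ℤ.* + d             ≡⟨ reorder (+ n) (+ a) z (+ d) ⟩
      + a ℤ.* z ℤ.* (+ n ℤ.* + d)           ≡⟨ cong (λ x → + a ℤ.* z ℤ.* x) (ℤ.pos-* n d) ⟨
      + a ℤ.* z ℤ.* + (n ℕ.* d)             ≡⟨ cong (λ x → + a ℤ.* z ℤ.* + x) (ℕ.*-identityˡ (n ℕ.* d)) ⟨
      + a ℤ.* z ℤ.* + (1 ℕ.* (n ℕ.* d))     ∎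
      where
      reorder : ∀ n a z d → n ℤ.* a ℤ.* z ℤ.* d ≡ a ℤ.* z ℤ.* (n ℤ.* d)
      reorder = solve-∀

module Sums where

  open import Data.Nat using (zero; suc; NonZero)
  open import Data.Integer using (ℤ)
  import Data.Integer.Properties as ℤ
  open import Data.Rational using (ℚ; 0ℚ; _/_; _+_; _*_; _-_)
  import Data.Rational.Properties as ℚ
  open import Data.Fin using (Fin; zero; suc)
  open import Algebra.Properties.Semiring.Sum ℤ.+-*-semiring using (sum)
  open import Tactic.RingSolver using (solve-∀)
  open import Relation.Binary.PropositionalEquality
  open Fractions using (/-+)

  Σ-cong : ∀ {n} {f g : Fin n → ℚ} → (∀ k → f k ≡ g k) → Σ f ≡ Σ g
  Σ-cong {zero}  f≗g = refl
  Σ-cong {suc n} f≗g = cong₂ _+_ (f≗g zero) (Σ-cong (λ k → f≗g (suc k)))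

  Σ-zero : ∀ {n} {f : Fin n → ℚ} → (∀ k → f k ≡ 0ℚ) → Σ f ≡ 0ℚ
  Σ-zero {zero}  f≗0 = refl
  Σ-zero {suc n} f≗0 = trans (cong₂ _+_ (f≗0 zero) (Σ-zero (λ k → f≗0 (suc k)))) (ℚ.+-identityˡ 0ℚ)

  Σ-distrib-- : ∀ {n} (f g : Fin n → ℚ) → Σ (λ k → f k - g k) ≡ Σ f - Σ g
  Σ-distrib-- {zero}  f g = refl
  Σ-distrib-- {suc n} f g = trans (cong (f zero - g zero +_) (Σ-distrib-- (λ k → f (suc k)) (λ k → g (suc k))))
    (interchange (f zero) (g zero) (Σ (λ k → f (suc k))) (Σ (λ k → g (suc k))))
    where
    interchange : ∀ a b x y → a - b + (x - y) ≡ a + x - (b + y)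
    interchange = solve-∀ ℚ-ring

  *-distribˡ-Σ : ∀ {n} c (f : Fin n → ℚ) → Σ (λ k → c * f k) ≡ c * Σ f
  *-distribˡ-Σ {zero}  c f = sym (ℚ.*-zeroʳ c)
  *-distribˡ-Σ {suc n} c f = trans (cong (c * f zero +_) (*-distribˡ-Σ c (λ k → f (suc k))))
    (sym (ℚ.*-distribˡ-+ c (f zero) (Σ (λ k → f (suc k)))))

  Σ-/ : ∀ {n} (f : Fin n → ℤ) d .{{_ : NonZero d}} → Σ (λ k → f k / d) ≡ sum f / d
  Σ-/ {zero}  f d = sym (ℚ.0/n≡0 d)
  Σ-/ {suc n} f d = trans (cong (f zero / d +_) (Σ-/ (λ k → f (suc k)) d)) (/-+ (f zero) _ d)

module Vandermonde where

  open import Data.Nat using (suc)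
  open import Data.Rational using (ℚ; 0ℚ; 1ℚ; _+_; _*_; _-_; 1/_; ≢-nonZero; +-*-rawSemiring)
  import Data.Rational.Properties as ℚ
  open import Algebra.Definitions.RawSemiring +-*-rawSemiring using (_^_)
  open import Algebra.Properties.Group ℚ.+-0-group using (x∙y⁻¹≈ε⇒x≈y)
  open import Data.Fin using (Fin; zero; suc; toℕ; inject₁)
  open import Data.Fin.Properties using (toℕ-inject₁; 0≢1+n; suc-injective)
  open import Function using (_∘_)
  open import Function.Definitions using (Injective)
  open import Tactic.RingSolver using (solve-∀)
  open import Relation.Binary.PropositionalEquality
  open ≡-Reasoning
  open Sums

  p*q≡0⇒q≡0 : ∀ {p q} → p ≢ 0ℚ → p * q ≡ 0ℚ → q ≡ 0ℚ
  p*q≡0⇒q≡0 {p} {q} p≢0 p*q≡0 = begin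
    q              ≡⟨ ℚ.*-identityˡ q ⟨
    1ℚ * q         ≡⟨ cong (_* q) (ℚ.*-inverseˡ p) ⟨
    1/ p * p * q   ≡⟨ ℚ.*-assoc (1/ p) p q ⟩
    1/ p * (p * q) ≡⟨ cong (1/ p *_) p*q≡0 ⟩
    1/ p * 0ℚ      ≡⟨ ℚ.*-zeroʳ (1/ p) ⟩
    0ℚ             ∎
    where instance _ = ≢-nonZero p≢0

  -- Replacing d k by (x k - x₀) * d k keeps every power sum zero and kills the zeroth unknown.
  vandermonde-kernel-trivial : ∀ {n} (x d : Fin n → ℚ) → Injective _≡_ _≡_ x → (∀ k → x k ≢ 0ℚ) →
    (∀ (j : Fin n) → Σ (λ k → x k ^ suc (toℕ j) * d k) ≡ 0ℚ) → ∀ k → d k ≡ 0ℚ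
  vandermonde-kernel-trivial {suc n} x d x-inj x≢0 Σx^[1+j]d≡0 = d≡0
    where
    x₀ = x zero
    e : Fin (suc n) → ℚ
    e k = (x k - x₀) * d k

    Σx^[1+j]e≡0 : ∀ (j : Fin n) → Σ (λ k → x k ^ suc (toℕ j) * e k) ≡ 0ℚ
    Σx^[1+j]e≡0 j = begin
      Σ (λ k → x k ^ suc t * e k)
        ≡⟨ Σ-cong (λ k → expand (x k ^ suc t) (x k) x₀ (d k)) ⟩
      Σ (λ k → x k ^ suc (suc t) * d k - x₀ * (x k ^ suc t * d k))
        ≡⟨ Σ-distrib-- (λ k → x k ^ suc (suc t) * d k) (λ k → x₀ * (x k ^ suc t * d k)) ⟩
      Σ (λ k → x k ^ suc (suc t) * d k) - Σ (λ k → x₀ * (x k ^ suc t * d k))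
        ≡⟨ cong (Σ (λ k → x k ^ suc (suc t) * d k) -_) (*-distribˡ-Σ x₀ (λ k → x k ^ suc t * d k)) ⟩
      Σ (λ k → x k ^ suc (suc t) * d k) - x₀ * Σ (λ k → x k ^ suc t * d k)
        ≡⟨ cong₂ (λ u v → u - x₀ * v) (Σx^[1+j]d≡0 (suc j)) Σx^[1+t]d≡0 ⟩
      0ℚ - x₀ * 0ℚ
        ≡⟨ cong (0ℚ -_) (ℚ.*-zeroʳ x₀) ⟩
      0ℚ - 0ℚ
        ≡⟨⟩
      0ℚ ∎
      where
      t = toℕ j
      Σx^[1+t]d≡0 : Σ (λ k → x k ^ suc t * d k) ≡ 0ℚ
      Σx^[1+t]d≡0 =
        subst (λ i → Σ (λ k → x k ^ suc i * d k) ≡ 0ℚ) (toℕ-inject₁ j) (Σx^[1+j]d≡0 (inject₁ j))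
      expand : ∀ P y y₀ c → P * ((y - y₀) * c) ≡ y * P * c - y₀ * (P * c)
      expand = solve-∀ ℚ-ring

    e₀≡0 : e zero ≡ 0ℚ
    e₀≡0 = trans (cong (_* d zero) (ℚ.+-inverseʳ x₀)) (ℚ.*-zeroˡ (d zero))

    e-tail≡0 : ∀ k → e (suc k) ≡ 0ℚ
    e-tail≡0 =
      vandermonde-kernel-trivial (x ∘ suc) (e ∘ suc) (suc-injective ∘ x-inj) (x≢0 ∘ suc) Σtail≡0
      where
      Σtail≡0 : ∀ (j : Fin n) → Σ (λ k → x (suc k) ^ suc (toℕ j) * e (suc k)) ≡ 0ℚ
      Σtail≡0 j = begin
        Σtail                     ≡⟨ ℚ.+-identityˡ Σtail ⟨
        0ℚ + Σtail                ≡⟨ cong (_+ Σtail) (trans (cong (P *_) e₀≡0) (ℚ.*-zeroʳ P)) ⟨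
        P * e zero + Σtail        ≡⟨ Σx^[1+j]e≡0 j ⟩
        0ℚ                        ∎
        where
        P = x₀ ^ suc (toℕ j)
        Σtail = Σ (λ k → x (suc k) ^ suc (toℕ j) * e (suc k))

    d-tail≡0 : ∀ k → d (suc k) ≡ 0ℚ
    d-tail≡0 k =
      p*q≡0⇒q≡0 (λ eq → 0≢1+n (sym (x-inj (x∙y⁻¹≈ε⇒x≈y (x (suc k)) x₀ eq)))) (e-tail≡0 k)

    d≡0 : ∀ k → d k ≡ 0ℚ
    d≡0 (suc k) = d-tail≡0 k
    d≡0 zero    = p*q≡0⇒q≡0 (x≢0 zero) (begin
      x₀ * d zero                                            ≡⟨ cong (_* d zero) (ℚ.*-identityʳ x₀) ⟨
      x₀ ^ 1 * d zero                                        ≡⟨ ℚ.+-identityʳ (x₀ ^ 1 * d zero) ⟨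
      x₀ ^ 1 * d zero + 0ℚ                                   ≡⟨ cong (x₀ ^ 1 * d zero +_) (Σ-zero tail≡0) ⟨
      x₀ ^ 1 * d zero + Σ (λ k → x (suc k) ^ 1 * d (suc k))  ≡⟨ Σx^[1+j]d≡0 zero ⟩
      0ℚ                                                     ∎)
      where
      tail≡0 : ∀ k → x (suc k) ^ 1 * d (suc k) ≡ 0ℚ
      tail≡0 k = trans (cong (x (suc k) ^ 1 *_) (d-tail≡0 k)) (ℚ.*-zeroʳ (x (suc k) ^ 1))

open import Data.Nat as ℕ using (suc; NonZero)
import Data.Nat.Properties as ℕ
open import Data.Integer as ℤ using (+_; 1ℤ)
import Data.Integer.Properties as ℤ
open import Data.Rational as ℚ using (0ℚ; _/_; +-*-rawSemiring)
import Data.Rational.Properties as ℚ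
open import Algebra.Definitions.RawSemiring +-*-rawSemiring using (_^_)
open import Algebra.Properties.Group ℚ.+-0-group using (x∙y⁻¹≈ε⇒x≈y)
open import Data.Fin using (zero; suc; toℕ)
open import Data.Fin.Properties using (toℕ<n; toℕ-injective)
open import Function.Bundles using (mk⇔)
open import Function.Definitions using (Injective)
open import Relation.Binary.Definitions using (tri<; tri≈; tri>)
open import Relation.Nullary using (contradiction)
open import Tactic.RingSolver using (solve-∀)
open import Relation.Binary.PropositionalEquality using (_≢_; sym; trans; cong; cong₂; module ≡-Reasoning)
open ≡-Reasoning
open Binomial using (central)
open Moments using (b; δ; moment; moments)
open Fractions using (⟦⟧-^; ⟦⟧-injective; ⟦n*a⟧*[z/[n*d]]≡[a*z]/d; /-cross)
open Sums using (Σ-cong; Σ-distrib--; Σ-/)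
open Vandermonde using (vandermonde-kernel-trivial)

m^[2n]≡[m*m]^n : ∀ m n → m ℕ.^ (2 ℕ.* n) ≡ (m ℕ.* m) ℕ.^ n
m^[2n]≡[m*m]^n m n = trans (sym (ℕ.^-*-assoc m 2 n)) (cong (λ x → (m ℕ.* x) ℕ.^ n) (ℕ.*-identityʳ m))

m*m≡n*n⇒m≡n : ∀ {m n} → m ℕ.* m ≡ n ℕ.* n → m ≡ n
m*m≡n*n⇒m≡n {m} {n} eq with ℕ.<-cmp m n
... | tri< m<n _ _ = contradiction eq (ℕ.<⇒≢ (ℕ.*-mono-< m<n m<n))
... | tri≈ _ m≡n _ = m≡n
... | tri> _ _ n<m = contradiction (sym eq) (ℕ.<⇒≢ (ℕ.*-mono-< n<m n<m))

solutions-unique : ∀ {m} {a a′ : Fin m → ℚ} → Solves m a → Solves m a′ → ∀ k → a k ≡ a′ k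
solutions-unique {m} {a} {a′} a-solves a′-solves k = x∙y⁻¹≈ε⇒x≈y (a k) (a′ k)
  (vandermonde-kernel-trivial x (λ k → a k ℚ.- a′ k) x-injective x≢0 Σ≡0 k)
  where
  x : Fin m → ℚ
  x k = ⟦ idx k ℕ.* idx k ⟧
  x-injective : Injective _≡_ _≡_ x
  x-injective eq = toℕ-injective (ℕ.suc-injective (m*m≡n*n⇒m≡n (⟦⟧-injective eq)))
  x≢0 : ∀ k → x k ≢ 0ℚ
  x≢0 k eq with ⟦⟧-injective {idx k ℕ.* idx k} {0} eq
  ... | ()
  Σ≡0 : ∀ j → Σ (λ k → x k ^ suc (toℕ j) ℚ.* (a k ℚ.- a′ k)) ≡ 0ℚ
  Σ≡0 j = begin
    Σ (λ k → x k ^ suc (toℕ j) ℚ.* (a k ℚ.- a′ k))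
      ≡⟨ Σ-cong {m} (λ k → trans (cong (ℚ._* (a k ℚ.- a′ k)) (x^[1+j]≡c k)) (distrib (c k) (a k) (a′ k))) ⟩
    Σ (λ k → c k ℚ.* a k ℚ.- c k ℚ.* a′ k)
      ≡⟨ Σ-distrib-- (λ k → c k ℚ.* a k) (λ k → c k ℚ.* a′ k) ⟩
    Σ (λ k → c k ℚ.* a k) ℚ.- Σ (λ k → c k ℚ.* a′ k)
      ≡⟨ cong₂ ℚ._-_ (a-solves j) (a′-solves j) ⟩
    e₁ j ℚ.- e₁ j
      ≡⟨ ℚ.+-inverseʳ (e₁ j) ⟩
    0ℚ
      ∎
    where
    c : Fin m → ℚ
    c k = ⟦ idx k ℕ.^ (2 ℕ.* idx j) ⟧
    x^[1+j]≡c : ∀ k → x k ^ idx j ≡ c k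
    x^[1+j]≡c k =
      sym (trans (cong ⟦_⟧ (m^[2n]≡[m*m]^n (idx k) (idx j))) (⟦⟧-^ (idx k ℕ.* idx k) (idx j)))
    distrib : ∀ c a a′ → c ℚ.* (a ℚ.- a′) ≡ c ℚ.* a ℚ.- c ℚ.* a′
    distrib = solve-∀ ℚ-ring

[δ*d]/d≡e₁ : ∀ {m} (j : Fin m) d .{{_ : NonZero d}} → (δ (toℕ j) ℤ.* + d) / d ≡ e₁ j
[δ*d]/d≡e₁ zero    d = /-cross (1ℤ ℤ.* + d) d 1ℤ 1 (ℤ.*-identityʳ (1ℤ ℤ.* + d))
[δ*d]/d≡e₁ (suc j) d = ℚ.0/n≡0 d

formula-solves : ∀ m → Solves m (λ k → formula m (idx k))
formula-solves m j = begin
  Σ {m} (λ k → ⟦ idx k ℕ.^ (2 ℕ.* idx j) ⟧ ℚ.* formula m (idx k))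
    ≡⟨ Σ-cong {m} term ⟩
  Σ {m} (λ k → (+ ((idx k ℕ.* idx k) ℕ.^ toℕ j) ℤ.* b m (idx k)) / central m)
    ≡⟨ Σ-/ {m} (λ k → + ((idx k ℕ.* idx k) ℕ.^ toℕ j) ℤ.* b m (idx k)) (central m) ⟩
  moment m (toℕ j) / central m
    ≡⟨ cong (_/ central m) (moments m (toℕ j) (toℕ<n j)) ⟩
  (δ (toℕ j) ℤ.* + central m) / central m
    ≡⟨ [δ*d]/d≡e₁ j (central m) ⟩
  e₁ j ∎
  where
  instance
    central≢0 : NonZero (central m)
    central≢0 = ℕ.>-nonZero (C-pos (2 ℕ.* m) m (ℕ.m≤m+n m _))
  term : ∀ k → ⟦ idx k ℕ.^ (2 ℕ.* idx j) ⟧ ℚ.* formula m (idx k) ≡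
               (+ ((idx k ℕ.* idx k) ℕ.^ toℕ j) ℤ.* b m (idx k)) / central m
  term k = trans (cong (λ n → ⟦ n ⟧ ℚ.* formula m (idx k)) (m^[2n]≡[m*m]^n (idx k) (idx j)))
    (⟦n*a⟧*[z/[n*d]]≡[a*z]/d (idx k ℕ.* idx k) ((idx k ℕ.* idx k) ℕ.^ toℕ j) (b m (idx k)) (central m))

theorem2p2 : (m : ℕ) → 1 ≤ m → (a : Fin m → ℚ) →
    Solves m a ⇔ ((k : Fin m) → a k ≡ formula m (idx k))
theorem2p2 m _ a = mk⇔
  (λ a-solves → solutions-unique a-solves (formula-solves m))
  (λ a≗formula j → trans (Σ-cong {m} (λ k → cong (⟦ idx k ℕ.^ (2 ℕ.* idx j) ⟧ ℚ.*_) (a≗formula k)))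
                         (formula-solves m j))
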